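{- Let $B=(\tilde U\,\dot\cup\,U,E)$ and $B'=(\tilde U\,\dot\cup\,U,E')$ be bipartite graphs with $|U|\ge|\tilde U|$ and $\mathrm{ndist}_{\tilde U}(B,B')\le s$. Suppose there are positive integers $x,n_1,n_2,n_3$ such that (i) $\deg_{B'}(\tilde u)\ge n_1$ for all $\tilde u\in\tilde U$; (ii) $|N_{B'}(\tilde S)|\ge x|\tilde S|$ for all $\tilde S\subseteq\tilde U$ with $|\tilde S|\le n_2$; (iii) $e_{B'}(\tilde S,S)\le\frac{n_1}{n_3}|\tilde S||S|$ for all $\tilde S\subseteq\tilde U$, $S\subseteq U$ with $xn_2\le|S|<|\tilde S|<n_3$; (iv) $|N_B(S)\cap\tilde S|>s$ for all $\tilde S\subseteq\tilde U$, $S\subseteq U$ with $|\tilde S|\ge n_3$ and $|S|>|U|-|\tilde S|$. Then $B'$ has a matching covering $\tilde U$.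
   Context: For bipartite graphs $B,B'$ on the same vertex set $U\,\dot\cup\,\tilde U$, $\mathrm{ndist}_{\tilde U}(B,B')$ is the number of vertices $\tilde u\in\tilde U$ with $N_B(\tilde u)\ne N_{B'}(\tilde u)$. $N_B(S)$ denotes the set of vertices having a neighbour in $S$. -}

module Defs where

open import Data.Nat using (ℕ; zero; suc; _+_)
open import Data.Bool using (Bool; true; false; _∧_; not)
open import Data.Bool.Properties using () renaming (_≟_ to _≟ᵇ_)
open import Data.Fin using (Fin)
open import Data.Fin.Subset using (Subset; ∣_∣; _∩_)
open import Data.Vec using (Vec; tabulate; lookup)
open import Data.Vec.Properties using (≡-dec)
open import Data.List using (List; map; allFin)
open import Data.Bool.ListAction using (any)
open import Data.Nat.ListAction using (sum)
open import Relation.Nullary using (does)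

-- A bipartite graph with parts Ũ = Fin m and U = Fin n, given by its
-- edge indicator: Bip m n ũ u = true iff ũu is an edge.
Bip : ℕ → ℕ → Set
Bip m n = Fin m → Fin n → Bool

nbhdŨ : ∀ {m n} → Bip m n → Fin m → Subset n
nbhdŨ B ũ = tabulate (B ũ)

degŨ : ∀ {m n} → Bip m n → Fin m → ℕ
degŨ B ũ = ∣ nbhdŨ B ũ ∣

ndistŨ : ∀ {m n} → Bip m n → Bip m n → ℕ
ndistŨ B B' = ∣ tabulate (λ ũ → not (does (≡-dec _≟ᵇ_ (nbhdŨ B ũ) (nbhdŨ B' ũ)))) ∣

NŨ : ∀ {m n} → Bip m n → Subset m → Subset n
NŨ {m} B S̃ = tabulate (λ u → any (λ ũ → lookup S̃ ũ ∧ B ũ u) (allFin m))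

NU : ∀ {m n} → Bip m n → Subset n → Subset m
NU {m} {n} B S = tabulate (λ ũ → any (λ u → lookup S u ∧ B ũ u) (allFin n))

eB : ∀ {m n} → Bip m n → Subset m → Subset n → ℕ
eB {m} B S̃ S = sum (map (λ ũ → ∣ tabulate (λ u → lookup S̃ ũ ∧ (lookup S u ∧ B ũ u)) ∣) (allFin m))

module Submission where

-- By Hall's theorem it suffices to show |N_B'(S̃)| ≥ |S̃| for
-- every S̃ ⊆ Ũ, and we split on the size of S̃:
--   * |S̃| ≤ n₂ : expansion (ii) gives |N_B'(S̃)| ≥ x|S̃| ≥ |S̃|;
--   * n₂ < |S̃| < n₃ : if S̃ were deficient, its neighbourhood N would have
--     size ≥ x n₂ (by (ii) on an n₂-subset), so the sparsity bound (iii)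
--     applies to (S̃, N); together with the degree bound (i), which forces
--     e(S̃, N) ≥ n₁|S̃|, this yields n₃ ≤ |N| < |S̃| < n₃;
--   * |S̃| ≥ n₃ : if S̃ were deficient, S = U ∖ N_B'(S̃) is larger than
--     |U| - |S̃|, so by (iv) more than s vertices of S̃ have a B-neighbour
--     in S; none of these edges survives in B', so more than s vertices
--     changed their neighbourhood, contradicting ndist(B,B') ≤ s.

open import Defs
open import Data.Nat using (ℕ; _≤_; _<_; _*_; _∸_)
open import Data.Bool using (true)
open import Data.Fin using (Fin)
open import Data.Fin.Subset using (Subset; ∣_∣; _∩_)
open import Data.Product using (Σ; _×_)
open import Function.Definitions using (Injective)
open import Relation.Binary.PropositionalEquality using (_≡_)

open import Data.Nat using (zero; suc; _+_; z≤n; s≤s; _<?_; _≤?_; >-nonZero)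
open import Data.Nat.Properties
open import Data.Bool using (Bool; _∧_; not)
open import Data.Bool.Properties using (T-≡) renaming (_≟_ to _≟ᵇ_)
open import Data.Fin using (zero; suc) renaming (_≟_ to _≟ᶠ_)
open import Data.Fin.Properties using (any?)
open import Data.Fin.Subset using (_∪_; _∈_; _∉_; _⊆_; ⁅_⁆; ∁; Nonempty; inside; outside; _-_; ⊥)
open import Data.Fin.Subset.Properties
  using ( p⊆q⇒∣p∣≤∣q∣; p⊂q⇒∣p∣<∣q∣; x∈⁅x⁆; x∈⁅y⁆⇒x≡y; x∉⁅y⁆⇒x≢y; ∣⁅x⁆∣≡1; ∣⊥∣≡0; ⊥⊆; s⊆s
        ; x∈p∪q⁻; x∈p∪q⁺; x∈p∩q⁺; x∈p∩q⁻; x∉p⇒x∈∁p; x∈∁p⇒x∉p; x∈p∧x≢y⇒x∈p-y; x∈p⇒∣p-x∣<∣p∣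
        ; _∈?_; nonempty?; Empty-unique; anySubset?; ∣p∣≤n; ∣∁p∣≡n∸∣p∣)
open import Data.Vec using ([]; _∷_; tabulate; lookup; here; there)
open import Data.Vec.Properties using (lookup∘tabulate; []=⇒lookup; lookup⇒[]=; ≡-dec)
open import Data.List using (map; allFin) renaming (tabulate to tabulateₗ)
open import Data.List.Properties using (map-tabulate)
import Data.List.Relation.Unary.Any as Any
open import Data.List.Relation.Unary.Any.Properties using (any⁺; any⁻)
open import Data.List.Membership.Propositional using (lose)
open import Data.List.Membership.Propositional.Properties using (∈-allFin)
open import Data.Bool.ListAction using (any)
open import Data.Nat.ListAction using (sum)
open import Data.Product using (_,_; proj₁; proj₂; ∃)
open import Data.Sum using (_⊎_; inj₁; inj₂; [_,_])
open import Data.Empty using (⊥-elim)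
open import Function using (id; _∘_)
open import Function.Bundles using (Equivalence)
open import Relation.Nullary using (Dec; yes; no; ¬_; does)
open import Relation.Nullary.Decidable using (_×-dec_; ¬?)
open import Relation.Binary.PropositionalEquality using (refl; sym; trans; cong; cong₂; subst; _≢_; ≢-sym; module ≡-Reasoning)

∧-split : ∀ {a b : Bool} → a ∧ b ≡ true → a ≡ true × b ≡ true
∧-split {true} {true} _ = refl , refl

∈-tabulate⁺ : ∀ {n} (f : Fin n → Bool) {x : Fin n} → f x ≡ true → x ∈ tabulate f
∈-tabulate⁺ f {x} fx = lookup⇒[]= x (tabulate f) (trans (lookup∘tabulate f x) fx)

∈-tabulate⁻ : ∀ {n} (f : Fin n → Bool) {x : Fin n} → x ∈ tabulate f → f x ≡ true
∈-tabulate⁻ f {x} x∈ = trans (sym (lookup∘tabulate f x)) ([]=⇒lookup x∈)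

any-allFin⁺ : ∀ {n} (p : Fin n → Bool) {i : Fin n} → p i ≡ true → any p (allFin n) ≡ true
any-allFin⁺ p {i} pi =
  Equivalence.to T-≡ (any⁺ p (lose (∈-allFin i) (Equivalence.from T-≡ pi)))

any-allFin⁻ : ∀ {n} (p : Fin n → Bool) → any p (allFin n) ≡ true → ∃ λ i → p i ≡ true
any-allFin⁻ {n} p holds with Any.satisfied (any⁻ p (allFin n) (Equivalence.from T-≡ holds))
... | i , pi = i , Equivalence.to T-≡ pi

∈NŨ⁺ : ∀ {m n} (G : Bip m n) {S̃ : Subset m} {ũ : Fin m} {u : Fin n} →
  ũ ∈ S̃ → G ũ u ≡ true → u ∈ NŨ G S̃
∈NŨ⁺ G {S̃} {ũ} {u} ũ∈ edge =
  ∈-tabulate⁺ _ (any-allFin⁺ (λ ũ' → lookup S̃ ũ' ∧ G ũ' u) (cong₂ _∧_ ([]=⇒lookup ũ∈) edge))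

∈NŨ⁻ : ∀ {m n} (G : Bip m n) {S̃ : Subset m} {u : Fin n} →
  u ∈ NŨ G S̃ → ∃ λ ũ → ũ ∈ S̃ × G ũ u ≡ true
∈NŨ⁻ G {S̃} {u} u∈ with any-allFin⁻ (λ ũ → lookup S̃ ũ ∧ G ũ u) (∈-tabulate⁻ _ u∈)
... | ũ , holds with ∧-split holds
...   | ũ∈ , edge = ũ , lookup⇒[]= ũ S̃ ũ∈ , edge

∈NU⁻ : ∀ {m n} (G : Bip m n) {S : Subset n} {ũ : Fin m} →
  ũ ∈ NU G S → ∃ λ u → u ∈ S × G ũ u ≡ true
∈NU⁻ G {S} {ũ} ũ∈ with any-allFin⁻ (λ u → lookup S u ∧ G ũ u) (∈-tabulate⁻ _ ũ∈)
... | u , holds with ∧-split holds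
...   | u∈ , edge = u , lookup⇒[]= u S u∈ , edge

NŨ-mono : ∀ {m n} (G : Bip m n) {S̃ T̃ : Subset m} → S̃ ⊆ T̃ → NŨ G S̃ ⊆ NŨ G T̃
NŨ-mono G S̃⊆T̃ u∈ with ∈NŨ⁻ G u∈
... | ũ , ũ∈ , edge = ∈NŨ⁺ G (S̃⊆T̃ ũ∈) edge

∣p∪q∣+∣p∩q∣≡∣p∣+∣q∣ : ∀ {n} (p q : Subset n) → ∣ p ∪ q ∣ + ∣ p ∩ q ∣ ≡ ∣ p ∣ + ∣ q ∣
∣p∪q∣+∣p∩q∣≡∣p∣+∣q∣ [] [] = refl
∣p∪q∣+∣p∩q∣≡∣p∣+∣q∣ (inside ∷ p) (inside ∷ q) =
  cong suc (trans (+-suc _ _) (trans (cong suc (∣p∪q∣+∣p∩q∣≡∣p∣+∣q∣ p q)) (sym (+-suc _ _))))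
∣p∪q∣+∣p∩q∣≡∣p∣+∣q∣ (inside ∷ p) (outside ∷ q) = cong suc (∣p∪q∣+∣p∩q∣≡∣p∣+∣q∣ p q)
∣p∪q∣+∣p∩q∣≡∣p∣+∣q∣ (outside ∷ p) (inside ∷ q) =
  trans (cong suc (∣p∪q∣+∣p∩q∣≡∣p∣+∣q∣ p q)) (sym (+-suc _ _))
∣p∪q∣+∣p∩q∣≡∣p∣+∣q∣ (outside ∷ p) (outside ∷ q) = ∣p∪q∣+∣p∩q∣≡∣p∣+∣q∣ p q

∣p∪q∣≤∣p∣+∣q∣ : ∀ {n} (p q : Subset n) → ∣ p ∪ q ∣ ≤ ∣ p ∣ + ∣ q ∣
∣p∪q∣≤∣p∣+∣q∣ p q = ≤-trans (m≤m+n _ _) (≤-reflexive (∣p∪q∣+∣p∩q∣≡∣p∣+∣q∣ p q))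

∣p∣≤∣p∩∁⁅x⁆∣+1 : ∀ {n} (p : Subset n) (x : Fin n) → ∣ p ∣ ≤ ∣ p ∩ ∁ ⁅ x ⁆ ∣ + 1
∣p∣≤∣p∩∁⁅x⁆∣+1 p x = begin
  ∣ p ∣                          ≤⟨ p⊆q⇒∣p∣≤∣q∣ split ⟩
  ∣ (p ∩ ∁ ⁅ x ⁆) ∪ ⁅ x ⁆ ∣      ≤⟨ ∣p∪q∣≤∣p∣+∣q∣ (p ∩ ∁ ⁅ x ⁆) ⁅ x ⁆ ⟩
  ∣ p ∩ ∁ ⁅ x ⁆ ∣ + ∣ ⁅ x ⁆ ∣    ≡⟨ cong (∣ p ∩ ∁ ⁅ x ⁆ ∣ +_) (∣⁅x⁆∣≡1 x) ⟩
  ∣ p ∩ ∁ ⁅ x ⁆ ∣ + 1            ∎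
  where
  open ≤-Reasoning
  split : p ⊆ (p ∩ ∁ ⁅ x ⁆) ∪ ⁅ x ⁆
  split {y} y∈p with y ∈? ⁅ x ⁆
  ... | yes y∈x = x∈p∪q⁺ (inj₂ y∈x)
  ... | no  y∉x = x∈p∪q⁺ (inj₁ (x∈p∩q⁺ (y∈p , x∉p⇒x∈∁p y∉x)))

two-points : ∀ {n} {x y : Fin n} → x ≢ y → 2 ≤ ∣ ⁅ x ⁆ ∪ ⁅ y ⁆ ∣
two-points {x = x} {y} x≢y = begin
  2                          ≡⟨ cong suc (sym (∣⁅x⁆∣≡1 y)) ⟩
  suc ∣ ⁅ y ⁆ ∣              ≤⟨ s≤s (p⊆q⇒∣p∣≤∣q∣ y-remains) ⟩
  suc ∣ ⁅ x ⁆ ∪ ⁅ y ⁆ - x ∣   ≤⟨ x∈p⇒∣p-x∣<∣p∣ (x∈p∪q⁺ (inj₁ (x∈⁅x⁆ x))) ⟩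
  ∣ ⁅ x ⁆ ∪ ⁅ y ⁆ ∣           ∎
  where
  open ≤-Reasoning
  y-remains : ⁅ y ⁆ ⊆ ⁅ x ⁆ ∪ ⁅ y ⁆ - x
  y-remains z∈ rewrite x∈⁅y⁆⇒x≡y y z∈ = x∈p∧x≢y⇒x∈p-y (x∈p∪q⁺ (inj₂ (x∈⁅x⁆ y))) (≢-sym x≢y)

nonempty-of-size : ∀ {n} (p : Subset n) → 0 < ∣ p ∣ → Nonempty p
nonempty-of-size {n} p 0<∣p∣ with nonempty? p
... | yes ne   = ne
... | no empty = ⊥-elim (<-irrefl (sym (∣⊥∣≡0 n)) (subst (λ q → 0 < ∣ q ∣) (Empty-unique {p = p} empty) 0<∣p∣))

subset-of-size : ∀ {n} (p : Subset n) (k : ℕ) → k ≤ ∣ p ∣ → ∃ λ q → q ⊆ p × ∣ q ∣ ≡ k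
subset-of-size {n} p zero _ = ⊥ , ⊥⊆ , ∣⊥∣≡0 n
subset-of-size (inside ∷ p) (suc k) (s≤s k≤∣p∣) with subset-of-size p k k≤∣p∣
... | q , q⊆p , ∣q∣≡k = inside ∷ q , s⊆s q⊆p , cong suc ∣q∣≡k
subset-of-size (outside ∷ p) (suc k) k<∣p∣ with subset-of-size p (suc k) k<∣p∣
... | q , q⊆p , ∣q∣≡k = outside ∷ q , s⊆s q⊆p , ∣q∣≡k

sumFin : ∀ {m} → (Fin m → ℕ) → ℕ
sumFin {zero}  f = 0
sumFin {suc m} f = f zero + sumFin (f ∘ suc)

sum-map-allFin : ∀ {m} (f : Fin m → ℕ) → sum (map f (allFin m)) ≡ sumFin f
sum-map-allFin f = trans (cong sum (map-tabulate id f)) (sum-tabulate f)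
  where
  sum-tabulate : ∀ {m} (g : Fin m → ℕ) → sum (tabulateₗ g) ≡ sumFin g
  sum-tabulate {zero}  g = refl
  sum-tabulate {suc m} g = cong (g zero +_) (sum-tabulate (g ∘ suc))

sumFin-mono : ∀ {m} (f g : Fin m → ℕ) → (∀ i → f i ≤ g i) → sumFin f ≤ sumFin g
sumFin-mono {zero}  f g f≤g = z≤n
sumFin-mono {suc m} f g f≤g = +-mono-≤ (f≤g zero) (sumFin-mono (f ∘ suc) (g ∘ suc) (f≤g ∘ suc))

sumFin-mono-< : ∀ {m} (f g : Fin m → ℕ) → (∀ i → f i ≤ g i) → ∀ j → f j < g j → sumFin f < sumFin g
sumFin-mono-< f g f≤g zero    fj<gj = +-mono-<-≤ fj<gj (sumFin-mono (f ∘ suc) (g ∘ suc) (f≤g ∘ suc))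
sumFin-mono-< f g f≤g (suc j) fj<gj = +-mono-≤-< (f≤g zero) (sumFin-mono-< (f ∘ suc) (g ∘ suc) (f≤g ∘ suc) j fj<gj)

sumFin-over-subset : ∀ {m} (p : Subset m) (c : ℕ) (f : Fin m → ℕ) →
  (∀ {i} → i ∈ p → c ≤ f i) → c * ∣ p ∣ ≤ sumFin f
sumFin-over-subset [] c f _ = ≤-reflexive (*-zeroʳ c)
sumFin-over-subset (inside ∷ p) c f f≥c = begin
  c * suc ∣ p ∣             ≡⟨ *-suc c ∣ p ∣ ⟩
  c + c * ∣ p ∣             ≤⟨ +-mono-≤ (f≥c here) (sumFin-over-subset p c (f ∘ suc) (f≥c ∘ there)) ⟩
  f zero + sumFin (f ∘ suc) ∎
  where open ≤-Reasoning
sumFin-over-subset (outside ∷ p) c f f≥c =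
  ≤-trans (sumFin-over-subset p c (f ∘ suc) (f≥c ∘ there)) (m≤n+m _ (f zero))

edges-into-neighbourhood : ∀ {m n} (G : Bip m n) (d : ℕ) → (∀ ũ → d ≤ degŨ G ũ) →
  (S̃ : Subset m) → d * ∣ S̃ ∣ ≤ eB G S̃ (NŨ G S̃)
edges-into-neighbourhood {m} G d deg S̃ = begin
  d * ∣ S̃ ∣                    ≤⟨ sumFin-over-subset S̃ d row row-large ⟩
  sumFin row                   ≡⟨ sym (sum-map-allFin row) ⟩
  sum (map row (allFin m))     ∎
  where
  open ≤-Reasoning
  N = NŨ G S̃
  row : Fin m → ℕ
  row ũ = ∣ tabulate (λ u → lookup S̃ ũ ∧ (lookup N u ∧ G ũ u)) ∣
  row-large : ∀ {ũ} → ũ ∈ S̃ → d ≤ row ũ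
  row-large {ũ} ũ∈ = ≤-trans (deg ũ) (p⊆q⇒∣p∣≤∣q∣ λ u∈ →
    let edge = ∈-tabulate⁻ (G ũ) u∈ in
    ∈-tabulate⁺ _ (cong₂ _∧_ ([]=⇒lookup ũ∈) (cong₂ _∧_ ([]=⇒lookup (∈NŨ⁺ G ũ∈ edge)) edge)))

-- Hall's theorem.

Hall : ∀ {m n} → Bip m n → Set
Hall {m} G = (S̃ : Subset m) → ∣ S̃ ∣ ≤ ∣ NŨ G S̃ ∣

Matching : ∀ {m n} → Bip m n → Set
Matching {m} {n} G = Σ (Fin m → Fin n) (λ f → Injective _≡_ _≡_ f × ((ũ : Fin m) → G ũ (f ũ) ≡ true))

hall-or-deficient : ∀ {m n} (G : Bip m n) → Hall G ⊎ ∃ λ S̃ → ∣ NŨ G S̃ ∣ < ∣ S̃ ∣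
hall-or-deficient G with anySubset? (λ S̃ → ∣ NŨ G S̃ ∣ <? ∣ S̃ ∣)
... | yes deficient = inj₂ deficient
... | no  none      = inj₁ (λ S̃ → ≮⇒≥ (λ lt → none (S̃ , lt)))

deleteEdge : ∀ {m n} → Bip m n → Fin m → Fin n → Bip m n
deleteEdge G a b i j = not (does (i ≟ᶠ a) ∧ does (j ≟ᶠ b)) ∧ G i j

deleteEdge-⊆ : ∀ {m n} (G : Bip m n) {a b i j} → deleteEdge G a b i j ≡ true → G i j ≡ true
deleteEdge-⊆ G e = proj₂ (∧-split e)

deleteEdge-keeps : ∀ {m n} (G : Bip m n) {a b i j} → G i j ≡ true → i ≢ a ⊎ j ≢ b →
  deleteEdge G a b i j ≡ true
deleteEdge-keeps G {a} {b} {i} {j} edge other with i ≟ᶠ a | j ≟ᶠ b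
... | yes i≡a | yes j≡b = ⊥-elim ([ (λ i≢a → i≢a i≡a) , (λ j≢b → j≢b j≡b) ] other)
... | yes _   | no  _   = edge
... | no  _   | _       = edge

deleteEdge-survives : ∀ {m n} (G : Bip m n) {a b i j} → G i j ≡ true →
  deleteEdge G a b i j ≡ true ⊎ (i ≡ a × j ≡ b)
deleteEdge-survives G {a} {b} {i} {j} edge with i ≟ᶠ a | j ≟ᶠ b
... | yes i≡a | yes j≡b = inj₂ (i≡a , j≡b)
... | yes _   | no  _   = inj₁ edge
... | no  _   | _       = inj₁ edge

edgeCount : ∀ {m n} → Bip m n → ℕ
edgeCount G = sumFin (degŨ G)

deleteEdge-decreases : ∀ {m n} (G : Bip m n) {a b} → G a b ≡ true →
  edgeCount (deleteEdge G a b) < edgeCount G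
deleteEdge-decreases G {a} {b} edge =
  sumFin-mono-< _ _ (λ i → p⊆q⇒∣p∣≤∣q∣ (shrinks i)) a
    (p⊂q⇒∣p∣<∣q∣ (shrinks a , b , ∈-tabulate⁺ _ edge , gone))
  where
  shrinks : ∀ i → nbhdŨ (deleteEdge G a b) i ⊆ nbhdŨ G i
  shrinks i u∈ = ∈-tabulate⁺ _ (deleteEdge-⊆ G (∈-tabulate⁻ _ u∈))
  gone : b ∉ nbhdŨ (deleteEdge G a b) a
  gone b∈ with a ≟ᶠ a | b ≟ᶠ b | ∈-tabulate⁻ (deleteEdge G a b a) b∈
  ... | yes _  | yes _  | ()
  ... | no a≢a | _      | _ = a≢a refl
  ... | yes _  | no b≢b | _ = b≢b refl

deficient-contains : ∀ {m n} (G : Bip m n) {ũ u} → Hall G → (S̃ : Subset m) →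
  ∣ NŨ (deleteEdge G ũ u) S̃ ∣ < ∣ S̃ ∣ → ũ ∈ S̃
deficient-contains G {ũ} {u} hall S̃ deficient with ũ ∈? S̃
... | yes ũ∈ = ũ∈
... | no  ũ∉ = ⊥-elim (<⇒≱ deficient (≤-trans (hall S̃) (p⊆q⇒∣p∣≤∣q∣ unchanged)))
  where
  unchanged : NŨ G S̃ ⊆ NŨ (deleteEdge G ũ u) S̃
  unchanged u'∈ with ∈NŨ⁻ G u'∈
  ... | ũ' , ũ'∈ , edge = ∈NŨ⁺ (deleteEdge G ũ u) ũ'∈ (deleteEdge-keeps G edge (inj₁ λ { refl → ũ∉ ũ'∈ }))

-- The counting step of Rado's exchange argument: deficient sets A, C whose
-- neighbourhoods X, Y satisfy |A ∪ C| ≤ |X ∪ Y| and |A ∩ C| ≤ |X ∩ Y| + 1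
-- cannot exist.
exchange-count : ∀ {a c a∪c a∩c x y x∪y x∩y : ℕ} →
  a∪c + a∩c ≡ a + c → x∪y + x∩y ≡ x + y →
  a∪c ≤ x∪y → a∩c ≤ x∩y + 1 → x < a → y < c → Data.Empty.⊥
exchange-count {a} {c} {a∪c} {a∩c} {x} {y} {x∪y} {x∩y} sizeA sizeX ∪-bound ∩-bound x<a y<c =
  1+n≰n (begin
    suc (suc (x + y))    ≡⟨ cong suc (sym (+-suc x y)) ⟩
    suc x + suc y        ≤⟨ +-mono-≤ x<a y<c ⟩
    a + c                ≡⟨ sym sizeA ⟩
    a∪c + a∩c            ≤⟨ +-mono-≤ ∪-bound ∩-bound ⟩
    x∪y + (x∩y + 1)      ≡⟨ cong (x∪y +_) (+-comm x∩y 1) ⟩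
    x∪y + suc x∩y        ≡⟨ +-suc x∪y x∩y ⟩
    suc (x∪y + x∩y)      ≡⟨ cong suc sizeX ⟩
    suc (x + y)          ∎)
  where open ≤-Reasoning

exchange : ∀ {m n} (G : Bip m n) {ũ u₁ u₂} → Hall G →
  G ũ u₁ ≡ true → G ũ u₂ ≡ true → u₁ ≢ u₂ →
  Hall (deleteEdge G ũ u₁) ⊎ Hall (deleteEdge G ũ u₂)
exchange G {ũ} {u₁} {u₂} hall e₁ e₂ u₁≢u₂
  with hall-or-deficient (deleteEdge G ũ u₁) | hall-or-deficient (deleteEdge G ũ u₂)
... | inj₁ hall₁ | _          = inj₁ hall₁
... | inj₂ _     | inj₁ hall₂ = inj₂ hall₂
... | inj₂ (A , deficientA) | inj₂ (C , deficientC) =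
  ⊥-elim (exchange-count (∣p∪q∣+∣p∩q∣≡∣p∣+∣q∣ A C) (∣p∪q∣+∣p∩q∣≡∣p∣+∣q∣ X Y)
    (≤-trans (hall (A ∪ C)) (p⊆q⇒∣p∣≤∣q∣ union-covered))
    (≤-trans (∣p∣≤∣p∩∁⁅x⁆∣+1 (A ∩ C) ũ) (+-monoˡ-≤ 1 (≤-trans (hall D) (p⊆q⇒∣p∣≤∣q∣ core-covered))))
    deficientA deficientC)
  where
  G₁ = deleteEdge G ũ u₁
  G₂ = deleteEdge G ũ u₂
  X = NŨ G₁ A
  Y = NŨ G₂ C
  D = (A ∩ C) ∩ ∁ ⁅ ũ ⁆
  ũ∈A = deficient-contains G hall A deficientA
  ũ∈C = deficient-contains G hall C deficientC
  -- The deleted edge ũu₁ is still present in G₂, and ũu₂ in G₁.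
  union-covered : NŨ G (A ∪ C) ⊆ X ∪ Y
  union-covered u∈ with ∈NŨ⁻ G u∈
  ... | a , a∈ , edge with x∈p∪q⁻ A C a∈
  ...   | inj₁ a∈A with deleteEdge-survives G {ũ} {u₁} edge
  ...     | inj₁ edge₁ = x∈p∪q⁺ (inj₁ (∈NŨ⁺ G₁ a∈A edge₁))
  ...     | inj₂ (refl , refl) = x∈p∪q⁺ (inj₂ (∈NŨ⁺ G₂ ũ∈C (deleteEdge-keeps G edge (inj₂ u₁≢u₂))))
  union-covered u∈ | a , a∈ , edge | inj₂ a∈C with deleteEdge-survives G {ũ} {u₂} edge
  ...     | inj₁ edge₂ = x∈p∪q⁺ (inj₂ (∈NŨ⁺ G₂ a∈C edge₂))
  ...     | inj₂ (refl , refl) = x∈p∪q⁺ (inj₁ (∈NŨ⁺ G₁ ũ∈A (deleteEdge-keeps G edge (inj₂ (≢-sym u₁≢u₂)))))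
  -- Away from ũ nothing was deleted.
  core-covered : NŨ G D ⊆ X ∩ Y
  core-covered u∈ with ∈NŨ⁻ G u∈
  ... | d , d∈D , edge with x∈p∩q⁻ (A ∩ C) (∁ ⁅ ũ ⁆) d∈D
  ...   | d∈A∩C , d∈∁ũ with x∈p∩q⁻ A C d∈A∩C
  ...     | d∈A , d∈C =
    let d≢ũ = x∉⁅y⁆⇒x≢y (x∈∁p⇒x∉p d∈∁ũ) in
    x∈p∩q⁺ ( ∈NŨ⁺ G₁ d∈A (deleteEdge-keeps G edge (inj₁ d≢ũ))
           , ∈NŨ⁺ G₂ d∈C (deleteEdge-keeps G edge (inj₁ d≢ũ)))

Branching : ∀ {m n} → Bip m n → Set
Branching G = ∃ λ ũ → ∃ λ u₁ → ∃ λ u₂ → u₁ ≢ u₂ × G ũ u₁ ≡ true × G ũ u₂ ≡ true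

branching? : ∀ {m n} (G : Bip m n) → Dec (Branching G)
branching? G = any? λ ũ → any? λ u₁ → any? λ u₂ →
  ¬? (u₁ ≟ᶠ u₂) ×-dec (G ũ u₁ ≟ᵇ true) ×-dec (G ũ u₂ ≟ᵇ true)

-- Base case: under Hall's condition every vertex has a neighbour; if it is
-- unique, sending each vertex to it is injective, since two vertices with the
-- same neighbour would form a deficient pair.
matching-without-branching : ∀ {m n} (G : Bip m n) → Hall G → ¬ Branching G → Matching G
matching-without-branching {m} {n} G hall no-branching = f , f-injective , f-adjacent
  where
  unique : ∀ {ũ u u'} → G ũ u ≡ true → G ũ u' ≡ true → u' ≡ u
  unique {ũ} {u} {u'} e e' with u ≟ᶠ u'
  ... | yes u≡u' = sym u≡u'
  ... | no  u≢u' = ⊥-elim (no-branching (ũ , u , u' , u≢u' , e , e'))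
  neighbour : (ũ : Fin m) → ∃ λ u → G ũ u ≡ true
  neighbour ũ with nonempty-of-size (NŨ G ⁅ ũ ⁆) (≤-trans (≤-reflexive (sym (∣⁅x⁆∣≡1 ũ))) (hall ⁅ ũ ⁆))
  ... | u , u∈ with ∈NŨ⁻ G u∈
  ...   | ũ' , ũ'∈ , edge = u , subst (λ v → G v u ≡ true) (x∈⁅y⁆⇒x≡y ũ ũ'∈) edge
  f : Fin m → Fin n
  f ũ = proj₁ (neighbour ũ)
  f-adjacent : (ũ : Fin m) → G ũ (f ũ) ≡ true
  f-adjacent ũ = proj₂ (neighbour ũ)
  f-injective : Injective _≡_ _≡_ f
  f-injective {a} {b} fa≡fb with a ≟ᶠ b
  ... | yes a≡b = a≡b
  ... | no  a≢b = ⊥-elim (1+n≰n (begin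
          2                           ≤⟨ two-points a≢b ⟩
          ∣ ⁅ a ⁆ ∪ ⁅ b ⁆ ∣            ≤⟨ hall (⁅ a ⁆ ∪ ⁅ b ⁆) ⟩
          ∣ NŨ G (⁅ a ⁆ ∪ ⁅ b ⁆) ∣     ≤⟨ p⊆q⇒∣p∣≤∣q∣ one-neighbour ⟩
          ∣ ⁅ f a ⁆ ∣                  ≡⟨ ∣⁅x⁆∣≡1 (f a) ⟩
          1                           ∎))
    where
    open ≤-Reasoning
    one-neighbour : NŨ G (⁅ a ⁆ ∪ ⁅ b ⁆) ⊆ ⁅ f a ⁆
    one-neighbour u∈ with ∈NŨ⁻ G u∈
    ... | ũ , ũ∈ , edge with x∈p∪q⁻ ⁅ a ⁆ ⁅ b ⁆ ũ∈
    ...   | inj₁ ũ∈a rewrite x∈⁅y⁆⇒x≡y a ũ∈a | unique (f-adjacent a) edge = x∈⁅x⁆ (f a)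
    ...   | inj₂ ũ∈b rewrite x∈⁅y⁆⇒x≡y b ũ∈b | unique (f-adjacent b) edge | fa≡fb = x∈⁅x⁆ (f b)

deleteEdge-matching : ∀ {m n} (G : Bip m n) {a b} → Matching (deleteEdge G a b) → Matching G
deleteEdge-matching G (f , injective , adjacent) = f , injective , deleteEdge-⊆ G ∘ adjacent

-- Hall's theorem, by induction on the number of edges: delete edges at
-- branching vertices while keeping Hall's condition (exchange lemma).
hall-with-bound : ∀ {m n} (k : ℕ) (G : Bip m n) → edgeCount G < k → Hall G → Matching G
hall-with-bound (suc k) G (s≤s edges≤k) hall with branching? G
... | no  no-branching = matching-without-branching G hall no-branching
... | yes (ũ , u₁ , u₂ , u₁≢u₂ , e₁ , e₂) with exchange G hall e₁ e₂ u₁≢u₂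
...   | inj₁ hall₁ =
  deleteEdge-matching G (hall-with-bound k _ (<-≤-trans (deleteEdge-decreases G e₁) edges≤k) hall₁)
...   | inj₂ hall₂ =
  deleteEdge-matching G (hall-with-bound k _ (<-≤-trans (deleteEdge-decreases G e₂) edges≤k) hall₂)

hall-theorem : ∀ {m n} (G : Bip m n) → Hall G → Matching G
hall-theorem G = hall-with-bound (suc (edgeCount G)) G ≤-refl

changed : ∀ {m n} → Bip m n → Bip m n → Subset m
changed B B' = tabulate (λ ũ → not (does (≡-dec _≟ᵇ_ (nbhdŨ B ũ) (nbhdŨ B' ũ))))

-- A vertex of S̃ with a B-neighbour outside N_B'(S̃) has lost that edge in B'.
escaping-vertices-changed : ∀ {m n} (B B' : Bip m n) (S̃ : Subset m) →
  NU B (∁ (NŨ B' S̃)) ∩ S̃ ⊆ changed B B'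
escaping-vertices-changed B B' S̃ {ũ} ũ∈ with x∈p∩q⁻ (NU B (∁ (NŨ B' S̃))) S̃ ũ∈
... | ũ∈NU , ũ∈S̃ with ∈NU⁻ B ũ∈NU
...   | u , u∉N , edge = ∈-tabulate⁺ _ (differ (≡-dec _≟ᵇ_ (nbhdŨ B ũ) (nbhdŨ B' ũ)))
  where
  differ : (d : Dec (nbhdŨ B ũ ≡ nbhdŨ B' ũ)) → not (does d) ≡ true
  differ (no _)     = refl
  differ (yes same) = ⊥-elim (x∈∁p⇒x∉p u∉N (∈NŨ⁺ B' ũ∈S̃ edge'))
    where
    open ≡-Reasoning
    edge' : B' ũ u ≡ true
    edge' = begin
      B' ũ u                 ≡⟨ sym (lookup∘tabulate (B' ũ) u) ⟩
      lookup (nbhdŨ B' ũ) u  ≡⟨ cong (λ v → lookup v u) (sym same) ⟩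
      lookup (nbhdŨ B ũ) u   ≡⟨ lookup∘tabulate (B ũ) u ⟩
      B ũ u                  ≡⟨ edge ⟩
      true                   ∎

-- Large sets (|S̃| ≥ n₃) are not deficient in B': otherwise condition (iv),
-- applied to the complement of N_B'(S̃), yields more than s changed vertices.
large-sets-expand : ∀ {m n} (s n₃ : ℕ) (B B' : Bip m n) → m ≤ n → ndistŨ B B' ≤ s →
  ((S̃ : Subset m) (S : Subset n) → n₃ ≤ ∣ S̃ ∣ → n ∸ ∣ S̃ ∣ < ∣ S ∣ → s < ∣ NU B S ∩ S̃ ∣) →
  (S̃ : Subset m) → n₃ ≤ ∣ S̃ ∣ → ¬ (∣ NŨ B' S̃ ∣ < ∣ S̃ ∣)
large-sets-expand {n = n} s n₃ B B' m≤n ndist≤s dense S̃ large deficient =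
  <⇒≱ (dense S̃ S large S-large)
      (≤-trans (p⊆q⇒∣p∣≤∣q∣ (escaping-vertices-changed B B' S̃)) ndist≤s)
  where
  S = ∁ (NŨ B' S̃)
  S-large : n ∸ ∣ S̃ ∣ < ∣ S ∣
  S-large = subst (n ∸ ∣ S̃ ∣ <_) (sym (∣∁p∣≡n∸∣p∣ (NŨ B' S̃)))
              (∸-monoʳ-< deficient (≤-trans (∣p∣≤n S̃) m≤n))

-- Medium sets (n₂ < |S̃| < n₃) are not deficient in B': the neighbourhood N
-- of a deficient one would have size ≥ x n₂, so the sparsity bound (iii) and
-- the edge count n₁|S̃| ≤ e(S̃, N) would give n₃ ≤ |N| < |S̃| < n₃.
medium-sets-expand : ∀ {m n} (x n₁ n₂ n₃ : ℕ) (B' : Bip m n) → 1 ≤ n₁ →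
  ((ũ : Fin m) → n₁ ≤ degŨ B' ũ) →
  ((S̃ : Subset m) → ∣ S̃ ∣ ≤ n₂ → x * ∣ S̃ ∣ ≤ ∣ NŨ B' S̃ ∣) →
  ((S̃ : Subset m) (S : Subset n) → x * n₂ ≤ ∣ S ∣ → ∣ S ∣ < ∣ S̃ ∣ → ∣ S̃ ∣ < n₃ →
    n₃ * eB B' S̃ S ≤ n₁ * ∣ S̃ ∣ * ∣ S ∣) →
  (S̃ : Subset m) → n₂ < ∣ S̃ ∣ → ∣ S̃ ∣ < n₃ → ¬ (∣ NŨ B' S̃ ∣ < ∣ S̃ ∣)
medium-sets-expand x n₁ n₂ n₃ B' 1≤n₁ deg expand sparse S̃ n₂<∣S̃∣ ∣S̃∣<n₃ deficient =
  <-irrefl refl (≤-<-trans n₃≤∣N∣ (<-trans deficient ∣S̃∣<n₃))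
  where
  open ≤-Reasoning
  N = NŨ B' S̃
  T = subset-of-size S̃ n₂ (<⇒≤ n₂<∣S̃∣)
  N-large : x * n₂ ≤ ∣ N ∣
  N-large with T
  ... | T̃ , T̃⊆S̃ , ∣T̃∣≡n₂ = begin
    x * n₂         ≡⟨ cong (x *_) (sym ∣T̃∣≡n₂) ⟩
    x * ∣ T̃ ∣      ≤⟨ expand T̃ (≤-reflexive ∣T̃∣≡n₂) ⟩
    ∣ NŨ B' T̃ ∣    ≤⟨ p⊆q⇒∣p∣≤∣q∣ (NŨ-mono B' T̃⊆S̃) ⟩
    ∣ N ∣          ∎
  n₁∣S̃∣-positive : 1 ≤ n₁ * ∣ S̃ ∣
  n₁∣S̃∣-positive = *-mono-≤ 1≤n₁ (≤-trans (s≤s z≤n) n₂<∣S̃∣)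
  n₃≤∣N∣ : n₃ ≤ ∣ N ∣
  n₃≤∣N∣ = *-cancelˡ-≤ (n₁ * ∣ S̃ ∣) {{>-nonZero n₁∣S̃∣-positive}} (begin
    n₁ * ∣ S̃ ∣ * n₃    ≡⟨ *-comm (n₁ * ∣ S̃ ∣) n₃ ⟩
    n₃ * (n₁ * ∣ S̃ ∣)  ≤⟨ *-monoʳ-≤ n₃ (edges-into-neighbourhood B' n₁ deg S̃) ⟩
    n₃ * eB B' S̃ N     ≤⟨ sparse S̃ N N-large deficient ∣S̃∣<n₃ ⟩
    n₁ * ∣ S̃ ∣ * ∣ N ∣  ∎)

small-sets-expand : ∀ {m n} (x n₂ : ℕ) (B' : Bip m n) → 1 ≤ x →
  ((S̃ : Subset m) → ∣ S̃ ∣ ≤ n₂ → x * ∣ S̃ ∣ ≤ ∣ NŨ B' S̃ ∣) →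
  (S̃ : Subset m) → ∣ S̃ ∣ ≤ n₂ → ∣ S̃ ∣ ≤ ∣ NŨ B' S̃ ∣
small-sets-expand x n₂ B' 1≤x expand S̃ small = begin
  ∣ S̃ ∣          ≡⟨ sym (*-identityˡ ∣ S̃ ∣) ⟩
  1 * ∣ S̃ ∣      ≤⟨ *-monoˡ-≤ ∣ S̃ ∣ 1≤x ⟩
  x * ∣ S̃ ∣      ≤⟨ expand S̃ small ⟩
  ∣ NŨ B' S̃ ∣    ∎
  where open ≤-Reasoning

lemma11p8 : (m n s x n₁ n₂ n₃ : ℕ) (B B' : Bip m n) →
    m ≤ n →
    ndistŨ B B' ≤ s →
    1 ≤ x → 1 ≤ n₁ → 1 ≤ n₂ → 1 ≤ n₃ →
    ((ũ : Fin m) → n₁ ≤ degŨ B' ũ) →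
    ((S̃ : Subset m) → ∣ S̃ ∣ ≤ n₂ → x * ∣ S̃ ∣ ≤ ∣ NŨ B' S̃ ∣) →
    ((S̃ : Subset m) (S : Subset n) → x * n₂ ≤ ∣ S ∣ → ∣ S ∣ < ∣ S̃ ∣ → ∣ S̃ ∣ < n₃ →
      n₃ * eB B' S̃ S ≤ n₁ * ∣ S̃ ∣ * ∣ S ∣) →
    ((S̃ : Subset m) (S : Subset n) → n₃ ≤ ∣ S̃ ∣ → n ∸ ∣ S̃ ∣ < ∣ S ∣ →
      s < ∣ NU B S ∩ S̃ ∣) →
    Σ (Fin m → Fin n) (λ f → Injective _≡_ _≡_ f × ((ũ : Fin m) → B' ũ (f ũ) ≡ true))
lemma11p8 m n s x n₁ n₂ n₃ B B' m≤n ndist≤s 1≤x 1≤n₁ _ _ deg expand sparse dense =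
  hall-theorem B' hall-B'
  where
  hall-B' : Hall B'
  hall-B' S̃ with ∣ S̃ ∣ ≤? n₂ | ∣ S̃ ∣ <? n₃
  ... | yes small | _ = small-sets-expand x n₂ B' 1≤x expand S̃ small
  ... | no  big   | yes below-n₃ =
    ≮⇒≥ (medium-sets-expand x n₁ n₂ n₃ B' 1≤n₁ deg expand sparse S̃ (≰⇒> big) below-n₃)
  ... | no  _     | no  not-below-n₃ =
    ≮⇒≥ (large-sets-expand s n₃ B B' m≤n ndist≤s dense S̃ (≮⇒≥ not-below-n₃))
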